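{- Let $M=(E,\rho)$ be a matroid and $X$ an independent subset of $E$. Let $k=\rho(E)-\rho(X)$ and $n=|E-X|$. Then the contraction $M/X$ is isomorphic to the uniform matroid $U_n^k$ if and only if either $X$ is a basis of $M$, or the following two conditions are satisfied: (1) $X$ is a flat of $M$; (2) for all $Z\in\mathcal{Z}(M)-\{0_{\mathcal{Z}}\}$, we have $\mathrm{cl}(X\cup Z)=E$.
   Context: A matroid $M=(E,\rho)$ is given by its rank function. The closure operator is $\mathrm{cl}(X)=\{e\in E:\rho(X\cup e)=\rho(X)\}$ and the cyclic operator is $\mathrm{cyc}(X)=\{e\in X:\rho(X-e)=\rho(X)\}$. A flat is a set with $\mathrm{cl}(X)=X$; a cyclic flat satisfies additionally $\mathrm{cyc}(X)=X$. $\mathcal{Z}(M)$ is the lattice of cyclic flats under inclusion, and $0_{\mathcal{Z}}=\mathrm{cl}(\emptyset)$ is its bottom element. $M/X$ is the matroid on $E-X$ with rank $A\mapsto\rho(A\cup X)-\rho(X)$. $U_n^k$ is the uniform matroid on $n$ elements with rank function $A\mapsto\min\{|A|,k\}$. -}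

module Defs where

open import Data.Nat using (ℕ; _≤_; _+_; _∸_; _⊓_; _≟_)
open import Data.Bool using (Bool; true; false; _∧_)
open import Data.Fin using (Fin)
open import Data.Fin.Subset using (Subset; _∪_; _∩_; _⊆_; _∈_; _∉_; ∁; ⁅_⁆; _-_; ∣_∣; ⊤; ⊥)
open import Data.Fin.Subset.Properties using (_∈?_)
open import Data.Fin.Properties using (any?)
open import Data.Vec using (tabulate)
open import Data.Product using (Σ; ∃; _×_; _,_)
open import Relation.Nullary using (¬_; ⌊_⌋)
open import Relation.Nullary.Decidable using (_×-dec_)
open import Relation.Binary.PropositionalEquality using (_≡_; _≢_)
open import Function.Definitions using (Injective)

record Matroid (m : ℕ) : Set where
  field
    ρ          : Subset m → ℕ
    ρ-bounded  : ∀ X → ρ X ≤ ∣ X ∣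
    ρ-mono     : ∀ X Y → X ⊆ Y → ρ X ≤ ρ Y
    ρ-submod   : ∀ X Y → ρ (X ∪ Y) + ρ (X ∩ Y) ≤ ρ X + ρ Y

module _ {m : ℕ} (M : Matroid m) where
  open Matroid M

  cl : Subset m → Subset m
  cl X = tabulate (λ e → ⌊ ρ (X ∪ ⁅ e ⁆) ≟ ρ X ⌋)

  cyc : Subset m → Subset m
  cyc X = tabulate (λ e → ⌊ e ∈? X ⌋ ∧ ⌊ ρ (X - e) ≟ ρ X ⌋)

  IsFlat : Subset m → Set
  IsFlat X = cl X ≡ X

  IsCyclicFlat : Subset m → Set
  IsCyclicFlat X = cl X ≡ X × cyc X ≡ X

  0𝒵 : Subset m
  0𝒵 = cl ⊥

  Independent : Subset m → Set
  Independent X = ρ X ≡ ∣ X ∣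

  IsBasis : Subset m → Set
  IsBasis X = Independent X × (∀ Y → Independent Y → X ⊆ Y → Y ≡ X)

  -- rank function of the contraction M/X (on subsets A of E - X)
  contractRank : Subset m → Subset m → ℕ
  contractRank X A = ρ (A ∪ X) ∸ ρ X

uniformRank : (n k : ℕ) → Subset n → ℕ
uniformRank n k A = ∣ A ∣ ⊓ k

image : {n m : ℕ} → (Fin n → Fin m) → Subset n → Subset m
image {n} φ A = tabulate (λ e → ⌊ any? (λ i → (i ∈? A) ×-dec (φ i Data.Fin.≟ e)) ⌋)

-- M/X ≅ U_n^k : a bijection φ from Fin n (ground set of U_n^k) onto E - X
-- such that rank_{M/X}(φ[A]) = rank_{U_n^k}(A) for every A ⊆ Fin n.
ContractionIsoUniform : {m : ℕ} → Matroid m → Subset m → (n k : ℕ) → Set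
ContractionIsoUniform {m} M X n k =
  Σ (Fin n → Fin m) λ φ →
      Injective _≡_ _≡_ φ
    × (∀ i → φ i ∉ X)
    × (∀ e → e ∉ X → ∃ λ i → φ i ≡ e)
    × (∀ A → contractRank M X (image φ A) ≡ uniformRank n k A)

module Submission where

-- Write k = ρ(E) − ρ(X). As X is independent, M/X ≅ U_n^k says exactly that
-- ρ(A ∪ X) − ρ(X) = min(|A|, k) for every A ⊆ E − X, an isomorphism being any enumeration of E − X.
-- In U_n^k a point outside A lies in the closure of A only if |A| ≥ k, that is, only if A spans.
-- So if ρ(E) > |X|, taking A = ∅ shows that X is a flat; and for a nonzero cyclic flat Z, which is
-- not contained in the independent set X, a point e ∈ Z − X lies in cl(Z − e), so taking
-- A = (Z − X) − e shows that X ∪ Z spans. Conversely, let X be a flat with property (2). If A ∪ X is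
-- independent its contracted rank is |A| ≤ k. Otherwise A ∪ X contains a circuit C, not inside X;
-- cl(C) is a cyclic flat, nonzero since cl(∅) ⊆ X, and cl(A ∪ X) ⊇ X ∪ cl(C) spans.

open import Data.Bool using (Bool; T)
open import Data.Bool.Properties using (T-≡; T-∧)
open import Data.Empty using (⊥-elim)
open import Data.Fin using (Fin; zero; suc) renaming (_≟_ to _≟ᶠ_)
open import Data.Fin.Properties using (any?; suc-injective)
open import Data.Fin.Subset
  using (Subset; inside; outside; _∈_; _∉_; _⊆_; _⊂_; _∪_; _∩_; _─_; _-_; ∁; ⁅_⁆; ∣_∣; ⊤; ⊥; Empty)
open import Data.Fin.Subset.Properties
open import Data.Fin.Subset.Induction using (⊂-wellFounded; Acc; acc)
open import Data.Nat using (ℕ; suc; _+_; _∸_; _⊓_; _≤_; _<_; _≟_; _≤?_)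
open import Data.Nat.Properties hiding (suc-injective)
open import Data.Product using (∃; _×_; _,_; proj₁; proj₂; uncurry)
open import Data.Sum using (_⊎_; inj₁; inj₂; [_,_]′)
open import Data.Vec using (_∷_; []; here; there; tabulate)
open import Data.Vec.Properties using ([]=⇒lookup; lookup⇒[]=; lookup∘tabulate)
open import Function using (_∘_)
open import Function.Bundles using (_⇔_; mk⇔; Equivalence)
open import Function.Definitions using (Injective)
open import Relation.Binary.PropositionalEquality
open import Relation.Nullary using (¬_; yes; no; ⌊_⌋; ¬?)
open import Relation.Nullary.Decidable using (toWitness; fromWitness; decidable-stable; _×-dec_)

open import Defs

private variable
  n m : ℕ
  x y : Fin n
  p q r : Subset n

x∈p─q⇒x∉q : ∀ (p q : Subset n) → x ∈ p ─ q → x ∉ q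
x∈p─q⇒x∉q (_ ∷ p) (inside  ∷ q) (there x∈p─q) (there x∈q) = x∈p─q⇒x∉q p q x∈p─q x∈q
x∈p─q⇒x∉q (_ ∷ p) (outside ∷ q) (there x∈p─q) (there x∈q) = x∈p─q⇒x∉q p q x∈p─q x∈q

x∈p-y⇒x≢y : ∀ (p : Subset n) → x ∈ p - y → x ≢ y
x∈p-y⇒x≢y {y = y} p x∈p-y = x∉⁅y⁆⇒x≢y (x∈p─q⇒x∉q p ⁅ y ⁆ x∈p-y)

∪-least : p ⊆ r → q ⊆ r → p ∪ q ⊆ r
∪-least {p = p} {q = q} p⊆r q⊆r x∈p∪q = [ p⊆r , q⊆r ]′ (x∈p∪q⁻ p q x∈p∪q)

∪-swapʳ : ∀ (p q r : Subset n) → (p ∪ q) ∪ r ≡ (p ∪ r) ∪ q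
∪-swapʳ p q r = begin
  (p ∪ q) ∪ r ≡⟨ ∪-assoc p q r ⟩
  p ∪ (q ∪ r) ≡⟨ cong (p ∪_) (∪-comm q r) ⟩
  p ∪ (r ∪ q) ≡⟨ ∪-assoc p r q ⟨
  (p ∪ r) ∪ q ∎
  where open ≡-Reasoning

⁅x⁆⊆p : x ∈ p → ⁅ x ⁆ ⊆ p
⁅x⁆⊆p {x = x} {p = p} x∈p y∈⁅x⁆ = subst (_∈ p) (sym (x∈⁅y⁆⇒x≡y x y∈⁅x⁆)) x∈p

p⊆p-x∪⁅x⁆ : ∀ (p : Subset n) x → p ⊆ (p - x) ∪ ⁅ x ⁆
p⊆p-x∪⁅x⁆ p x {y} y∈p with y ≟ᶠ x
... | yes refl = q⊆p∪q (p - x) ⁅ x ⁆ (x∈⁅x⁆ x)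
... | no y≢x   = p⊆p∪q ⁅ x ⁆ (x∈p∧x≢y⇒x∈p-y y∈p y≢x)

⊆-or-∃∉ : ∀ (p q : Subset n) → p ⊆ q ⊎ ∃ λ x → x ∈ p × x ∉ q
⊆-or-∃∉ p q with any? (λ x → (x ∈? p) ×-dec ¬? (x ∈? q))
... | yes witness = inj₂ witness
... | no ¬witness = inj₁ λ {x} x∈p → decidable-stable (x ∈? q) (λ x∉q → ¬witness (x , x∈p , x∉q))

∣p∪q∣≡∣p∣+∣q∣ : p ⊆ ∁ q → ∣ p ∪ q ∣ ≡ ∣ p ∣ + ∣ q ∣
∣p∪q∣≡∣p∣+∣q∣ {p = []}          {[]}          _    = refl
∣p∪q∣≡∣p∣+∣q∣ {p = inside  ∷ p} {inside  ∷ q} p⊆∁q with () ← p⊆∁q here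
∣p∪q∣≡∣p∣+∣q∣ {p = inside  ∷ p} {outside ∷ q} p⊆∁q = cong suc (∣p∪q∣≡∣p∣+∣q∣ (drop-∷-⊆ p⊆∁q))
∣p∪q∣≡∣p∣+∣q∣ {p = outside ∷ p} {inside  ∷ q} p⊆∁q =
  trans (cong suc (∣p∪q∣≡∣p∣+∣q∣ (drop-∷-⊆ p⊆∁q))) (sym (+-suc ∣ p ∣ ∣ q ∣))
∣p∪q∣≡∣p∣+∣q∣ {p = outside ∷ p} {outside ∷ q} p⊆∁q = ∣p∪q∣≡∣p∣+∣q∣ (drop-∷-⊆ p⊆∁q)

∣p∪⁅x⁆∣≡1+∣p∣ : x ∉ p → ∣ p ∪ ⁅ x ⁆ ∣ ≡ suc ∣ p ∣
∣p∪⁅x⁆∣≡1+∣p∣ {x = x} {p = p} x∉p = begin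
  ∣ p ∪ ⁅ x ⁆ ∣     ≡⟨ ∣p∪q∣≡∣p∣+∣q∣ p⊆∁⁅x⁆ ⟩
  ∣ p ∣ + ∣ ⁅ x ⁆ ∣ ≡⟨ cong (∣ p ∣ +_) (∣⁅x⁆∣≡1 x) ⟩
  ∣ p ∣ + 1         ≡⟨ +-comm ∣ p ∣ 1 ⟩
  suc ∣ p ∣         ∎
  where
  open ≡-Reasoning
  p⊆∁⁅x⁆ : p ⊆ ∁ ⁅ x ⁆
  p⊆∁⁅x⁆ y∈p = x∉p⇒x∈∁p λ y∈⁅x⁆ → x∉p (subst (_∈ p) (x∈⁅y⁆⇒x≡y x y∈⁅x⁆) y∈p)

∣p∣≡1+∣p-x∣ : x ∈ p → ∣ p ∣ ≡ suc ∣ p - x ∣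
∣p∣≡1+∣p-x∣ {p = inside  ∷ p} here          = cong (suc ∘ ∣_∣) (sym (p─⊥≡p p))
∣p∣≡1+∣p-x∣ {p = inside  ∷ p} (there x∈p) = cong suc (∣p∣≡1+∣p-x∣ x∈p)
∣p∣≡1+∣p-x∣ {p = outside ∷ p} (there x∈p) = ∣p∣≡1+∣p-x∣ x∈p

∈tabulate⁻ : ∀ {f : Fin n → Bool} → x ∈ tabulate f → T (f x)
∈tabulate⁻ {x = x} {f} x∈ = Equivalence.from T-≡ (trans (sym (lookup∘tabulate f x)) ([]=⇒lookup x∈))

∈tabulate⁺ : ∀ {f : Fin n → Bool} → T (f x) → x ∈ tabulate f
∈tabulate⁺ {x = x} {f} fx = lookup⇒[]= x _ (trans (lookup∘tabulate f x) (Equivalence.to T-≡ fx))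

module _ (φ : Fin n → Fin m) where

  preimage : Subset m → Subset n
  preimage A = tabulate (λ i → ⌊ φ i ∈? A ⌋)

  ∈image⁻ : ∀ {B e} → e ∈ image φ B → ∃ λ i → i ∈ B × φ i ≡ e
  ∈image⁻ {B} {e} e∈ = toWitness {a? = any? (λ i → (i ∈? B) ×-dec (φ i ≟ᶠ e))} (∈tabulate⁻ e∈)

  ∈image⁺ : ∀ {B i} → i ∈ B → φ i ∈ image φ B
  ∈image⁺ {B} {i} i∈B =
    ∈tabulate⁺ (fromWitness {a? = any? (λ j → (j ∈? B) ×-dec (φ j ≟ᶠ φ i))} (i , i∈B , refl))

  image-preimage : ∀ {A} → (∀ {e} → e ∈ A → ∃ λ i → φ i ≡ e) → image φ (preimage A) ≡ A
  image-preimage {A} A⊆range = ⊆-antisym image⊆A A⊆image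
    where
    image⊆A : image φ (preimage A) ⊆ A
    image⊆A e∈ with ∈image⁻ e∈
    ... | i , i∈preimage , refl = toWitness {a? = φ _ ∈? A} (∈tabulate⁻ i∈preimage)
    A⊆image : A ⊆ image φ (preimage A)
    A⊆image e∈A with A⊆range e∈A
    ... | i , refl = ∈image⁺ (∈tabulate⁺ (fromWitness {a? = φ i ∈? A} e∈A))

  image-insert : ∀ {B i} → i ∈ B → image φ B ≡ image φ (B - i) ∪ ⁅ φ i ⁆
  image-insert {B} {i} i∈B =
    ⊆-antisym ⊆-split (∪-least (image-mono (p─q⊆p B ⁅ i ⁆)) (⁅x⁆⊆p (∈image⁺ i∈B)))
    where
    image-mono : ∀ {B C} → B ⊆ C → image φ B ⊆ image φ C
    image-mono B⊆C e∈ with ∈image⁻ e∈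
    ... | j , j∈B , refl = ∈image⁺ (B⊆C j∈B)
    ⊆-split : image φ B ⊆ image φ (B - i) ∪ ⁅ φ i ⁆
    ⊆-split e∈ with ∈image⁻ e∈
    ... | j , j∈B , refl with x∈p∪q⁻ (B - i) ⁅ i ⁆ (p⊆p-x∪⁅x⁆ B i j∈B)
    ...   | inj₁ j∈B-i = p⊆p∪q ⁅ φ i ⁆ (∈image⁺ j∈B-i)
    ...   | inj₂ j∈⁅i⁆ with refl ← x∈⁅y⁆⇒x≡y i j∈⁅i⁆ = q⊆p∪q (image φ (B - i)) ⁅ φ i ⁆ (x∈⁅x⁆ (φ i))

  ∣image∣≡∣∣ : Injective _≡_ _≡_ φ → ∀ B → ∣ image φ B ∣ ≡ ∣ B ∣
  ∣image∣≡∣∣ φ-inj B = go B (⊂-wellFounded B)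
    where
    go : ∀ B → Acc _⊂_ B → ∣ image φ B ∣ ≡ ∣ B ∣
    go B (acc rec) with nonempty? B
    ... | no B-empty = begin
      ∣ image φ B ∣ ≡⟨ cong ∣_∣ (Empty-unique image-empty) ⟩
      ∣ ⊥ {n = m} ∣ ≡⟨ ∣⊥∣≡0 m ⟩
      0             ≡⟨ ∣⊥∣≡0 n ⟨
      ∣ ⊥ {n = n} ∣ ≡⟨ cong ∣_∣ (Empty-unique B-empty) ⟨
      ∣ B ∣         ∎
      where
      open ≡-Reasoning
      image-empty : Empty (image φ B)
      image-empty (e , e∈) = let i , i∈B , _ = ∈image⁻ e∈ in B-empty (i , i∈B)
    ... | yes (i , i∈B) = begin
      ∣ image φ B ∣                 ≡⟨ cong ∣_∣ (image-insert i∈B) ⟩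
      ∣ image φ (B - i) ∪ ⁅ φ i ⁆ ∣ ≡⟨ ∣p∪⁅x⁆∣≡1+∣p∣ φi∉image ⟩
      suc ∣ image φ (B - i) ∣       ≡⟨ cong suc (go (B - i) (rec (x∈p⇒p-x⊂p i∈B))) ⟩
      suc ∣ B - i ∣                 ≡⟨ ∣p∣≡1+∣p-x∣ i∈B ⟨
      ∣ B ∣                         ∎
      where
      open ≡-Reasoning
      φi∉image : φ i ∉ image φ (B - i)
      φi∉image φi∈ with ∈image⁻ φi∈
      ... | j , j∈B-i , φj≡φi = x∈p-y⇒x≢y B j∈B-i (φ-inj φj≡φi)

enumerate : (p : Subset n) → Fin ∣ p ∣ → Fin n
enumerate (inside  ∷ p) zero    = zero
enumerate (inside  ∷ p) (suc i) = suc (enumerate p i)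
enumerate (outside ∷ p) i       = suc (enumerate p i)

enumerate-∈ : ∀ (p : Subset n) i → enumerate p i ∈ p
enumerate-∈ (inside  ∷ p) zero    = here
enumerate-∈ (inside  ∷ p) (suc i) = there (enumerate-∈ p i)
enumerate-∈ (outside ∷ p) i       = there (enumerate-∈ p i)

enumerate-injective : ∀ (p : Subset n) → Injective _≡_ _≡_ (enumerate p)
enumerate-injective (inside  ∷ p) {zero}  {zero}  _  = refl
enumerate-injective (inside  ∷ p) {suc i} {suc j} eq = cong suc (enumerate-injective p (suc-injective eq))
enumerate-injective (outside ∷ p)                 eq = enumerate-injective p (suc-injective eq)

enumerate-surjective : ∀ (p : Subset n) → x ∈ p → ∃ λ i → enumerate p i ≡ x
enumerate-surjective (inside  ∷ p) here        = zero , refl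
enumerate-surjective (inside  ∷ p) (there x∈p) with enumerate-surjective p x∈p
... | i , refl = suc i , refl
enumerate-surjective (outside ∷ p) (there x∈p) with enumerate-surjective p x∈p
... | i , refl = i , refl

module _ (M : Matroid m) where
  open Matroid M

  ρ-submod-⊆ : ∀ {U A B I} → U ⊆ A ∪ B → I ⊆ A ∩ B → ρ U + ρ I ≤ ρ A + ρ B
  ρ-submod-⊆ {U} {A} {B} {I} U⊆A∪B I⊆A∩B =
    ≤-trans (+-mono-≤ (ρ-mono U (A ∪ B) U⊆A∪B) (ρ-mono I (A ∩ B) I⊆A∩B)) (ρ-submod A B)

  ρ-subadditive : ∀ A B → ρ (A ∪ B) ≤ ρ A + ρ B
  ρ-subadditive A B = ≤-trans (m≤m+n (ρ (A ∪ B)) (ρ (A ∩ B))) (ρ-submod A B)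

  ρ≤ρ⊤ : ∀ S → ρ S ≤ ρ ⊤
  ρ≤ρ⊤ S = ρ-mono S ⊤ ⊆⊤

  ∈cl⁻ : ∀ {S x} → x ∈ cl M S → ρ (S ∪ ⁅ x ⁆) ≡ ρ S
  ∈cl⁻ {S} {x} x∈ = toWitness {a? = ρ (S ∪ ⁅ x ⁆) ≟ ρ S} (∈tabulate⁻ x∈)

  ρ∪⁅x⁆≤ρ⇒∈cl : ∀ {S x} → ρ (S ∪ ⁅ x ⁆) ≤ ρ S → x ∈ cl M S
  ρ∪⁅x⁆≤ρ⇒∈cl {S} {x} ≤ρS = ∈tabulate⁺ (fromWitness {a? = ρ (S ∪ ⁅ x ⁆) ≟ ρ S}
    (≤-antisym ≤ρS (ρ-mono S (S ∪ ⁅ x ⁆) (p⊆p∪q ⁅ x ⁆))))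

  ⊆cl : ∀ {S} → S ⊆ cl M S
  ⊆cl {S} {x} x∈S = ρ∪⁅x⁆≤ρ⇒∈cl (ρ-mono (S ∪ ⁅ x ⁆) S (∪-least ⊆-refl (⁅x⁆⊆p x∈S)))

  cl-mono : ∀ {S T} → S ⊆ T → cl M S ⊆ cl M T
  cl-mono {S} {T} S⊆T {x} x∈clS = ρ∪⁅x⁆≤ρ⇒∈cl (+-cancelʳ-≤ (ρ S) (ρ (T ∪ ⁅ x ⁆)) (ρ T) (begin
    ρ (T ∪ ⁅ x ⁆) + ρ S       ≤⟨ ρ-submod-⊆ T∪x⊆ S⊆ ⟩
    ρ T + ρ (S ∪ ⁅ x ⁆)       ≡⟨ cong (ρ T +_) (∈cl⁻ x∈clS) ⟩
    ρ T + ρ S                 ∎))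
    where
    open ≤-Reasoning
    T∪x⊆ : T ∪ ⁅ x ⁆ ⊆ T ∪ (S ∪ ⁅ x ⁆)
    T∪x⊆ = ∪-least (p⊆p∪q (S ∪ ⁅ x ⁆)) (q⊆p∪q T (S ∪ ⁅ x ⁆) ∘ q⊆p∪q S ⁅ x ⁆)
    S⊆ : S ⊆ T ∩ (S ∪ ⁅ x ⁆)
    S⊆ y∈S = x∈p∩q⁺ (S⊆T y∈S , p⊆p∪q ⁅ x ⁆ y∈S)

  ρ-∪-⊆cl : ∀ {S} T → T ⊆ cl M S → ρ (S ∪ T) ≤ ρ S
  ρ-∪-⊆cl {S} T T⊆clS = go T (⊂-wellFounded T) T⊆clS
    where
    go : ∀ T → Acc _⊂_ T → T ⊆ cl M S → ρ (S ∪ T) ≤ ρ S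
    go T (acc rec) T⊆clS with nonempty? T
    ... | no T-empty = ρ-mono (S ∪ T) S
      (∪-least ⊆-refl λ {y} y∈T → ⊥-elim (T-empty (y , y∈T)))
    ... | yes (y , y∈T) = begin
      ρ (S ∪ T)                   ≤⟨ ρ-mono _ _ S∪T⊆ ⟩
      ρ ((S ∪ (T - y)) ∪ ⁅ y ⁆)   ≡⟨ ∈cl⁻ (cl-mono (p⊆p∪q (T - y)) (T⊆clS y∈T)) ⟩
      ρ (S ∪ (T - y))             ≤⟨ go (T - y) (rec (x∈p⇒p-x⊂p y∈T)) (T⊆clS ∘ p─q⊆p T ⁅ y ⁆) ⟩
      ρ S                         ∎
      where
      open ≤-Reasoning
      ⊆-split : (T - y) ∪ ⁅ y ⁆ ⊆ (S ∪ (T - y)) ∪ ⁅ y ⁆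
      ⊆-split = ∪-least (p⊆p∪q ⁅ y ⁆ ∘ q⊆p∪q S (T - y)) (q⊆p∪q (S ∪ (T - y)) ⁅ y ⁆)
      S∪T⊆ : S ∪ T ⊆ (S ∪ (T - y)) ∪ ⁅ y ⁆
      S∪T⊆ = ∪-least (p⊆p∪q ⁅ y ⁆ ∘ p⊆p∪q (T - y)) (⊆-split ∘ p⊆p-x∪⁅x⁆ T y)

  ρ-cl : ∀ S → ρ (cl M S) ≡ ρ S
  ρ-cl S = ≤-antisym
    (≤-trans (ρ-mono (cl M S) (S ∪ cl M S) (q⊆p∪q S (cl M S))) (ρ-∪-⊆cl (cl M S) ⊆-refl))
    (ρ-mono S (cl M S) ⊆cl)

  cl-idem : ∀ S → cl M (cl M S) ≡ cl M S
  cl-idem S = ⊆-antisym clclS⊆clS ⊆cl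
    where
    clclS⊆clS : cl M (cl M S) ⊆ cl M S
    clclS⊆clS {x} x∈ = ρ∪⁅x⁆≤ρ⇒∈cl (begin
      ρ (S ∪ ⁅ x ⁆)      ≤⟨ ρ-mono _ _ (∪-least (p⊆p∪q ⁅ x ⁆ ∘ ⊆cl) (q⊆p∪q (cl M S) ⁅ x ⁆)) ⟩
      ρ (cl M S ∪ ⁅ x ⁆) ≡⟨ ∈cl⁻ x∈ ⟩
      ρ (cl M S)         ≡⟨ ρ-cl S ⟩
      ρ S                ∎)
      where open ≤-Reasoning

  cl≡⊤⇒ρ≡ρ⊤ : ∀ {S} → cl M S ≡ ⊤ → ρ S ≡ ρ ⊤
  cl≡⊤⇒ρ≡ρ⊤ {S} clS≡⊤ = trans (sym (ρ-cl S)) (cong ρ clS≡⊤)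

  ρ≡ρ⊤⇒cl≡⊤ : ∀ {S} → ρ S ≡ ρ ⊤ → cl M S ≡ ⊤
  ρ≡ρ⊤⇒cl≡⊤ {S} ρS≡ρ⊤ = ⊆-antisym ⊆⊤ λ {x} _ →
    ρ∪⁅x⁆≤ρ⇒∈cl (≤-trans (ρ≤ρ⊤ (S ∪ ⁅ x ⁆)) (≤-reflexive (sym ρS≡ρ⊤)))

  Independent-⊆ : ∀ {X Y} → Y ⊆ X → Independent M X → Independent M Y
  Independent-⊆ {X} {Y} Y⊆X X-indep = ≤-antisym (ρ-bounded Y) (+-cancelʳ-≤ ∣ X ─ Y ∣ ∣ Y ∣ (ρ Y) (begin
    ∣ Y ∣ + ∣ X ─ Y ∣ ≡⟨ ∣p∪q∣≡∣p∣+∣q∣ Y⊆∁[X─Y] ⟨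
    ∣ Y ∪ (X ─ Y) ∣   ≤⟨ p⊆q⇒∣p∣≤∣q∣ (∪-least Y⊆X (p─q⊆p X Y)) ⟩
    ∣ X ∣             ≡⟨ X-indep ⟨
    ρ X               ≤⟨ ρ-mono X (Y ∪ (X ─ Y)) X⊆Y∪[X─Y] ⟩
    ρ (Y ∪ (X ─ Y))   ≤⟨ ρ-subadditive Y (X ─ Y) ⟩
    ρ Y + ρ (X ─ Y)   ≤⟨ +-monoʳ-≤ (ρ Y) (ρ-bounded (X ─ Y)) ⟩
    ρ Y + ∣ X ─ Y ∣   ∎))
    where
    open ≤-Reasoning
    Y⊆∁[X─Y] : Y ⊆ ∁ (X ─ Y)
    Y⊆∁[X─Y] y∈Y = x∉p⇒x∈∁p λ y∈X─Y → x∈p─q⇒x∉q X Y y∈X─Y y∈Y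
    X⊆Y∪[X─Y] : X ⊆ Y ∪ (X ─ Y)
    X⊆Y∪[X─Y] {x} x∈X with x ∈? Y
    ... | yes x∈Y = p⊆p∪q (X ─ Y) x∈Y
    ... | no  x∉Y = q⊆p∪q Y (X ─ Y) (x∈p∧x∉q⇒x∈p─q x∈X x∉Y)

  Cyclic : Subset m → Set
  Cyclic C = ∀ {x} → x ∈ C → ρ (C - x) ≡ ρ C

  cyc≡⇒Cyclic : ∀ {C} → cyc M C ≡ C → Cyclic C
  cyc≡⇒Cyclic {C} cycC≡C {x} x∈C = toWitness {a? = ρ (C - x) ≟ ρ C}
    (proj₂ (Equivalence.to T-∧ (∈tabulate⁻ (subst (x ∈_) (sym cycC≡C) x∈C))))

  Cyclic⇒cyc≡ : ∀ {C} → Cyclic C → cyc M C ≡ C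
  Cyclic⇒cyc≡ {C} C-cyclic = ⊆-antisym cycC⊆C C⊆cycC
    where
    cycC⊆C : cyc M C ⊆ C
    cycC⊆C {x} x∈ = toWitness {a? = x ∈? C} (proj₁ (Equivalence.to T-∧ (∈tabulate⁻ x∈)))
    C⊆cycC : C ⊆ cyc M C
    C⊆cycC {x} x∈C = ∈tabulate⁺ (Equivalence.from T-∧
      (fromWitness {a? = x ∈? C} x∈C , fromWitness {a? = ρ (C - x) ≟ ρ C} (C-cyclic x∈C)))

  Cyclic⇒∈cl[-] : ∀ {C x} → Cyclic C → x ∈ C → x ∈ cl M (C - x)
  Cyclic⇒∈cl[-] {C} {x} C-cyclic x∈C = ρ∪⁅x⁆≤ρ⇒∈cl (begin
    ρ ((C - x) ∪ ⁅ x ⁆) ≤⟨ ρ-mono _ C (∪-least (p─q⊆p C ⁅ x ⁆) (⁅x⁆⊆p x∈C)) ⟩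
    ρ C                 ≡⟨ C-cyclic x∈C ⟨
    ρ (C - x)           ∎)
    where open ≤-Reasoning

  Cyclic-cl : ∀ {C} → Cyclic C → Cyclic (cl M C)
  Cyclic-cl {C} C-cyclic {x} x∈clC = ≤-antisym (ρ-mono _ _ (p─q⊆p (cl M C) ⁅ x ⁆)) (begin
    ρ (cl M C)     ≡⟨ ρ-cl C ⟩
    ρ C            ≤⟨ ρC≤ρ[C-x] ⟩
    ρ (C - x)      ≤⟨ ρ-mono _ _ (λ y∈ → x∈p∧x≢y⇒x∈p-y (⊆cl (p─q⊆p C ⁅ x ⁆ y∈)) (x∈p-y⇒x≢y C y∈)) ⟩
    ρ (cl M C - x) ∎)
    where
    open ≤-Reasoning
    ρC≤ρ[C-x] : ρ C ≤ ρ (C - x)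
    ρC≤ρ[C-x] with x ∈? C
    ... | yes x∈C = ≤-reflexive (sym (C-cyclic x∈C))
    ... | no  x∉C = ρ-mono _ _ λ y∈C → x∈p∧x≢y⇒x∈p-y y∈C λ { refl → x∉C y∈C }

  cl-IsCyclicFlat : ∀ {C} → Cyclic C → IsCyclicFlat M (cl M C)
  cl-IsCyclicFlat {C} C-cyclic = cl-idem C , Cyclic⇒cyc≡ (Cyclic-cl C-cyclic)

  Cyclic∧Independent⇒Empty : ∀ {C} → Cyclic C → Independent M C → Empty C
  Cyclic∧Independent⇒Empty {C} C-cyclic C-indep (x , x∈C) = <-irrefl refl (begin-strict
    ρ C       ≡⟨ C-cyclic x∈C ⟨
    ρ (C - x) ≤⟨ ρ-bounded (C - x) ⟩
    ∣ C - x ∣ <⟨ x∈p⇒∣p-x∣<∣p∣ x∈C ⟩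
    ∣ C ∣     ≡⟨ C-indep ⟨
    ρ C       ∎)
    where open ≤-Reasoning

  IsCyclicFlat∧⊆Independent⇒≡0𝒵 : ∀ {Z X} → IsCyclicFlat M Z → Independent M X → Z ⊆ X → Z ≡ 0𝒵 M
  IsCyclicFlat∧⊆Independent⇒≡0𝒵 {Z} (clZ≡Z , cycZ≡Z) X-indep Z⊆X = begin
    Z        ≡⟨ clZ≡Z ⟨
    cl M Z   ≡⟨ cong (cl M) (Empty-unique Z-empty) ⟩
    cl M ⊥   ∎
    where
    open ≡-Reasoning
    Z-empty : Empty Z
    Z-empty = Cyclic∧Independent⇒Empty (cyc≡⇒Cyclic cycZ≡Z) (Independent-⊆ Z⊆X X-indep)

  IsCircuit : Subset m → Set
  IsCircuit C = ¬ Independent M C × (∀ {x} → x ∈ C → Independent M (C - x))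

  circuit-⊆ : ∀ D → ¬ Independent M D → ∃ λ C → C ⊆ D × IsCircuit C
  circuit-⊆ D = go D (⊂-wellFounded D)
    where
    go : ∀ D → Acc _⊂_ D → ¬ Independent M D → ∃ λ C → C ⊆ D × IsCircuit C
    go D (acc rec) D-dep with any? (λ x → (x ∈? D) ×-dec ¬? (ρ (D - x) ≟ ∣ D - x ∣))
    ... | yes (x , x∈D , D-x-dep) =
      let C , C⊆D-x , C-circuit = go (D - x) (rec (x∈p⇒p-x⊂p x∈D)) D-x-dep
      in  C , p─q⊆p D ⁅ x ⁆ ∘ C⊆D-x , C-circuit
    ... | no  ¬witness = D , ⊆-refl , D-dep , λ {x} x∈D →
      decidable-stable (ρ (D - x) ≟ ∣ D - x ∣) λ D-x-dep → ¬witness (x , x∈D , D-x-dep)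

  IsCircuit⇒Cyclic : ∀ {C} → IsCircuit C → Cyclic C
  IsCircuit⇒Cyclic {C} (C-dep , C-x-indep) {x} x∈C = ≤-antisym (ρ-mono _ _ (p─q⊆p C ⁅ x ⁆))
    (m<1+n⇒m≤n (begin-strict
      ρ C             <⟨ ≤∧≢⇒< (ρ-bounded C) C-dep ⟩
      ∣ C ∣           ≡⟨ ∣p∣≡1+∣p-x∣ x∈C ⟩
      suc ∣ C - x ∣   ≡⟨ cong suc (C-x-indep x∈C) ⟨
      suc (ρ (C - x)) ∎))
    where open ≤-Reasoning

  Independent∧ρ⊤≤∣X∣⇒IsBasis : ∀ {X} → Independent M X → ρ ⊤ ≤ ∣ X ∣ → IsBasis M X
  Independent∧ρ⊤≤∣X∣⇒IsBasis {X} X-indep ρ⊤≤∣X∣ =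
    X-indep , λ Y Y-indep X⊆Y → ⊆-antisym (Y⊆X Y-indep X⊆Y) X⊆Y
    where
    Y⊆X : ∀ {Y} → Independent M Y → X ⊆ Y → Y ⊆ X
    Y⊆X {Y} Y-indep X⊆Y with ⊆-or-∃∉ Y X
    ... | inj₁ Y⊆X = Y⊆X
    ... | inj₂ (y , y∈Y , y∉X) = ⊥-elim (<-irrefl refl (begin-strict
      ∣ X ∣ <⟨ p⊂q⇒∣p∣<∣q∣ (X⊆Y , y , y∈Y , y∉X) ⟩
      ∣ Y ∣ ≡⟨ Y-indep ⟨
      ρ Y   ≤⟨ ρ≤ρ⊤ Y ⟩
      ρ ⊤   ≤⟨ ρ⊤≤∣X∣ ⟩
      ∣ X ∣ ∎))
      where open ≤-Reasoning

  IsBasis⇒spanning : ∀ {X} → IsBasis M X → ρ X ≡ ρ ⊤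
  IsBasis⇒spanning {X} (X-indep , X-maximal) = cl≡⊤⇒ρ≡ρ⊤ (⊆-antisym ⊆⊤ λ {x} _ → x∈clX x)
    where
    x∈clX : ∀ x → x ∈ cl M X
    x∈clX x with ρ (X ∪ ⁅ x ⁆) ≟ ρ X
    ... | yes ρ-same = ρ∪⁅x⁆≤ρ⇒∈cl (≤-reflexive ρ-same)
    ... | no  ρ-grows = ⊥-elim (x∉X x∈X)
      where
      x∉X : x ∉ X
      x∉X x∈X = ρ-grows (∈cl⁻ (⊆cl x∈X))
      X∪x-indep : Independent M (X ∪ ⁅ x ⁆)
      X∪x-indep = ≤-antisym (ρ-bounded _) (begin
        ∣ X ∪ ⁅ x ⁆ ∣ ≡⟨ ∣p∪⁅x⁆∣≡1+∣p∣ x∉X ⟩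
        suc ∣ X ∣     ≡⟨ cong suc X-indep ⟨
        suc (ρ X)     ≤⟨ ≤∧≢⇒< (ρ-mono _ _ (p⊆p∪q ⁅ x ⁆)) (ρ-grows ∘ sym) ⟩
        ρ (X ∪ ⁅ x ⁆) ∎)
        where open ≤-Reasoning
      x∈X : x ∈ X
      x∈X = subst (x ∈_) (X-maximal (X ∪ ⁅ x ⁆) X∪x-indep (p⊆p∪q ⁅ x ⁆)) (q⊆p∪q X ⁅ x ⁆ (x∈⁅x⁆ x))

1+m⊓n≡m⊓n⇒n≤m : ∀ {m n} → suc m ⊓ n ≡ m ⊓ n → n ≤ m
1+m⊓n≡m⊓n⇒n≤m {m} {n} eq with n ≤? m
... | yes n≤m = n≤m
... | no  n≰m = ⊥-elim (1+n≢n (begin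
  suc m     ≡⟨ m≤n⇒m⊓n≡m (≰⇒> n≰m) ⟨
  suc m ⊓ n ≡⟨ eq ⟩
  m ⊓ n     ≡⟨ m≤n⇒m⊓n≡m (<⇒≤ (≰⇒> n≰m)) ⟩
  m         ∎))
  where open ≡-Reasoning

UniformContraction : Matroid m → Subset m → ℕ → Set
UniformContraction M X k = ∀ A → A ⊆ ∁ X → contractRank M X A ≡ ∣ A ∣ ⊓ k

SpansWithCyclicFlats : Matroid m → Subset m → Set
SpansWithCyclicFlats M X = ∀ Z → IsCyclicFlat M Z → Z ≢ 0𝒵 M → cl M (X ∪ Z) ≡ ⊤

module _ (M : Matroid m) {X : Subset m} where
  open Matroid M

  ContractionIsoUniform⇒UniformContraction :
    ∀ {n k} → ContractionIsoUniform M X n k → UniformContraction M X k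
  ContractionIsoUniform⇒UniformContraction {k = k} (φ , φ-inj , _ , φ-onto , φ-rank) A A⊆∁X = begin
    contractRank M X A           ≡⟨ cong (contractRank M X) image≡A ⟨
    contractRank M X (image φ B) ≡⟨ φ-rank B ⟩
    ∣ B ∣ ⊓ k                    ≡⟨ cong (_⊓ k) (∣image∣≡∣∣ φ φ-inj B) ⟨
    ∣ image φ B ∣ ⊓ k            ≡⟨ cong (λ C → ∣ C ∣ ⊓ k) image≡A ⟩
    ∣ A ∣ ⊓ k                    ∎
    where
    open ≡-Reasoning
    B = preimage φ A
    image≡A : image φ B ≡ A
    image≡A = image-preimage φ λ {e} e∈A → φ-onto e (x∈∁p⇒x∉p (A⊆∁X e∈A))

  UniformContraction⇒ContractionIsoUniform :
    ∀ {k} → UniformContraction M X k → ContractionIsoUniform M X ∣ ∁ X ∣ k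
  UniformContraction⇒ContractionIsoUniform {k} unif =
    φ , enumerate-injective (∁ X) , (x∈∁p⇒x∉p ∘ enumerate-∈ (∁ X)) ,
    (λ e e∉X → enumerate-surjective (∁ X) (x∉p⇒x∈∁p e∉X)) ,
    λ B → trans (unif (image φ B) image⊆∁X) (cong (_⊓ k) (∣image∣≡∣∣ φ (enumerate-injective (∁ X)) B))
    where
    φ = enumerate (∁ X)
    image⊆∁X : ∀ {B} → image φ B ⊆ ∁ X
    image⊆∁X e∈ with ∈image⁻ φ e∈
    ... | i , _ , refl = enumerate-∈ (∁ X) i

  spanning⇒UniformContraction : ρ X ≡ ρ ⊤ → UniformContraction M X (ρ ⊤ ∸ ρ X)
  spanning⇒UniformContraction ρX≡ρ⊤ A _ = begin
    ρ (A ∪ X) ∸ ρ X   ≡⟨ cong (_∸ ρ X) (≤-antisym (ρ≤ρ⊤ M (A ∪ X)) ρ⊤≤ρ[A∪X]) ⟩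
    ρ ⊤ ∸ ρ X         ≡⟨ k≡0 ⟩
    0                 ≡⟨ ⊓-zeroʳ ∣ A ∣ ⟨
    ∣ A ∣ ⊓ 0         ≡⟨ cong (∣ A ∣ ⊓_) k≡0 ⟨
    ∣ A ∣ ⊓ (ρ ⊤ ∸ ρ X) ∎
    where
    open ≡-Reasoning
    k≡0 : ρ ⊤ ∸ ρ X ≡ 0
    k≡0 = trans (cong (_∸ ρ X) (sym ρX≡ρ⊤)) (n∸n≡0 (ρ X))
    ρ⊤≤ρ[A∪X] : ρ ⊤ ≤ ρ (A ∪ X)
    ρ⊤≤ρ[A∪X] = ≤-trans (≤-reflexive (sym ρX≡ρ⊤)) (ρ-mono X (A ∪ X) (q⊆p∪q A X))

module _ (M : Matroid m) {X : Subset m}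
         (unif : UniformContraction M X (Matroid.ρ M ⊤ ∸ Matroid.ρ M X)) where
  open Matroid M

  UniformContraction-∈cl⇒spanning :
    ∀ {A e} → A ⊆ ∁ X → e ∉ X → e ∉ A → e ∈ cl M (A ∪ X) → ρ (A ∪ X) ≡ ρ ⊤
  UniformContraction-∈cl⇒spanning {A} {e} A⊆∁X e∉X e∉A e∈cl =
    ∸-cancelʳ-≡ (ρ-mono X (A ∪ X) (q⊆p∪q A X)) (ρ≤ρ⊤ M X) (begin
      ρ (A ∪ X) ∸ ρ X       ≡⟨ unif A A⊆∁X ⟩
      ∣ A ∣ ⊓ (ρ ⊤ ∸ ρ X)   ≡⟨ m≥n⇒m⊓n≡n (1+m⊓n≡m⊓n⇒n≤m ⊓-unchanged) ⟩
      ρ ⊤ ∸ ρ X             ∎)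
    where
    open ≡-Reasoning
    ⊓-unchanged : suc ∣ A ∣ ⊓ (ρ ⊤ ∸ ρ X) ≡ ∣ A ∣ ⊓ (ρ ⊤ ∸ ρ X)
    ⊓-unchanged = begin
      suc ∣ A ∣ ⊓ (ρ ⊤ ∸ ρ X)       ≡⟨ cong (_⊓ (ρ ⊤ ∸ ρ X)) (∣p∪⁅x⁆∣≡1+∣p∣ e∉A) ⟨
      ∣ A ∪ ⁅ e ⁆ ∣ ⊓ (ρ ⊤ ∸ ρ X)   ≡⟨ unif (A ∪ ⁅ e ⁆) (∪-least A⊆∁X (⁅x⁆⊆p (x∉p⇒x∈∁p e∉X))) ⟨
      ρ ((A ∪ ⁅ e ⁆) ∪ X) ∸ ρ X     ≡⟨ cong (λ S → ρ S ∸ ρ X) (∪-swapʳ A ⁅ e ⁆ X) ⟩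
      ρ ((A ∪ X) ∪ ⁅ e ⁆) ∸ ρ X     ≡⟨ cong (_∸ ρ X) (∈cl⁻ M e∈cl) ⟩
      ρ (A ∪ X) ∸ ρ X               ≡⟨ unif A A⊆∁X ⟩
      ∣ A ∣ ⊓ (ρ ⊤ ∸ ρ X)           ∎

  UniformContraction⇒IsFlat : ρ X < ρ ⊤ → IsFlat M X
  UniformContraction⇒IsFlat ρX<ρ⊤ = ⊆-antisym clX⊆X (⊆cl M)
    where
    clX⊆X : cl M X ⊆ X
    clX⊆X {x} x∈clX = decidable-stable (x ∈? X) λ x∉X → <-irrefl (begin
      ρ X       ≡⟨ cong ρ (∪-identityˡ X) ⟨
      ρ (⊥ ∪ X) ≡⟨ UniformContraction-∈cl⇒spanning ⊥⊆ x∉X ∉⊥ x∈cl[⊥∪X] ⟩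
      ρ ⊤       ∎) ρX<ρ⊤
      where
      open ≡-Reasoning
      x∈cl[⊥∪X] : x ∈ cl M (⊥ ∪ X)
      x∈cl[⊥∪X] = subst (λ S → x ∈ cl M S) (sym (∪-identityˡ X)) x∈clX

  UniformContraction⇒SpansWithCyclicFlats : Independent M X → SpansWithCyclicFlats M X
  UniformContraction⇒SpansWithCyclicFlats X-indep Z Z-cyclicFlat Z≢0𝒵 with ⊆-or-∃∉ Z X
  ... | inj₁ Z⊆X = ⊥-elim (Z≢0𝒵 (IsCyclicFlat∧⊆Independent⇒≡0𝒵 M Z-cyclicFlat X-indep Z⊆X))
  ... | inj₂ (e , e∈Z , e∉X) = ρ≡ρ⊤⇒cl≡⊤ M (≤-antisym (ρ≤ρ⊤ M (X ∪ Z)) (begin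
    ρ ⊤       ≡⟨ UniformContraction-∈cl⇒spanning A⊆∁X e∉X e∉A e∈cl[A∪X] ⟨
    ρ (A ∪ X) ≤⟨ ρ-mono _ _ (∪-least (q⊆p∪q X Z ∘ p─q⊆p Z X ∘ p─q⊆p (Z ─ X) ⁅ e ⁆) (p⊆p∪q Z)) ⟩
    ρ (X ∪ Z) ∎))
    where
    open ≤-Reasoning
    A = Z ─ X - e
    A⊆∁X : A ⊆ ∁ X
    A⊆∁X x∈A = x∉p⇒x∈∁p (x∈p─q⇒x∉q Z X (p─q⊆p (Z ─ X) ⁅ e ⁆ x∈A))
    e∉A : e ∉ A
    e∉A e∈A = x∈p-y⇒x≢y (Z ─ X) e∈A refl
    Z-e⊆A∪X : Z - e ⊆ A ∪ X
    Z-e⊆A∪X {x} x∈Z-e with x ∈? X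
    ... | yes x∈X = q⊆p∪q A X x∈X
    ... | no  x∉X = p⊆p∪q X
      (x∈p∧x≢y⇒x∈p-y (x∈p∧x∉q⇒x∈p─q (p─q⊆p Z ⁅ e ⁆ x∈Z-e) x∉X) (x∈p-y⇒x≢y Z x∈Z-e))
    e∈cl[A∪X] : e ∈ cl M (A ∪ X)
    e∈cl[A∪X] = cl-mono M Z-e⊆A∪X (Cyclic⇒∈cl[-] M (cyc≡⇒Cyclic M (proj₂ Z-cyclicFlat)) e∈Z)

  UniformContraction⇒IsBasis⊎IsFlat×Spans :
    Independent M X → IsBasis M X ⊎ (IsFlat M X × SpansWithCyclicFlats M X)
  UniformContraction⇒IsBasis⊎IsFlat×Spans X-indep with ρ ⊤ ≤? ∣ X ∣
  ... | yes ρ⊤≤∣X∣ = inj₁ (Independent∧ρ⊤≤∣X∣⇒IsBasis M X-indep ρ⊤≤∣X∣)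
  ... | no  ρ⊤≰∣X∣ = inj₂ ( UniformContraction⇒IsFlat (subst (_< ρ ⊤) (sym X-indep) (≰⇒> ρ⊤≰∣X∣))
                         , UniformContraction⇒SpansWithCyclicFlats X-indep)

module _ (M : Matroid m) {X : Subset m} (X-indep : Independent M X)
         (X-flat : IsFlat M X) (X-spans : SpansWithCyclicFlats M X) where
  open Matroid M

  dependent-⊇⇒spanning : ∀ {D} → X ⊆ D → ¬ Independent M D → ρ D ≡ ρ ⊤
  dependent-⊇⇒spanning {D} X⊆D D-dep with circuit-⊆ M D D-dep
  ... | C , C⊆D , C-circuit with ⊆-or-∃∉ C X
  ...   | inj₁ C⊆X = ⊥-elim (proj₁ C-circuit (Independent-⊆ M C⊆X X-indep))
  ...   | inj₂ (e , e∈C , e∉X) = ≤-antisym (ρ≤ρ⊤ M D) (begin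
    ρ ⊤            ≡⟨ cl≡⊤⇒ρ≡ρ⊤ M (X-spans (cl M C) clC-cyclicFlat clC≢0𝒵) ⟨
    ρ (X ∪ cl M C) ≤⟨ ρ-mono _ _ (∪-least (⊆cl M ∘ X⊆D) (cl-mono M C⊆D)) ⟩
    ρ (cl M D)     ≡⟨ ρ-cl M D ⟩
    ρ D            ∎)
    where
    open ≤-Reasoning
    clC-cyclicFlat : IsCyclicFlat M (cl M C)
    clC-cyclicFlat = cl-IsCyclicFlat M (IsCircuit⇒Cyclic M C-circuit)
    clC≢0𝒵 : cl M C ≢ 0𝒵 M
    clC≢0𝒵 clC≡0𝒵 = e∉X (subst (e ∈_) X-flat (cl-mono M ⊥⊆ (subst (e ∈_) clC≡0𝒵 (⊆cl M e∈C))))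

  IsFlat∧SpansWithCyclicFlats⇒UniformContraction : UniformContraction M X (ρ ⊤ ∸ ρ X)
  IsFlat∧SpansWithCyclicFlats⇒UniformContraction A A⊆∁X with ρ (A ∪ X) ≟ ∣ A ∪ X ∣
  ... | yes A∪X-indep = begin
    ρ (A ∪ X) ∸ ρ X     ≡⟨ cong (_∸ ρ X) ρ[A∪X]≡∣A∣+ρX ⟩
    ∣ A ∣ + ρ X ∸ ρ X   ≡⟨ m+n∸n≡m ∣ A ∣ (ρ X) ⟩
    ∣ A ∣               ≡⟨ m≤n⇒m⊓n≡m ∣A∣≤k ⟨
    ∣ A ∣ ⊓ (ρ ⊤ ∸ ρ X) ∎
    where
    open ≡-Reasoning
    ρ[A∪X]≡∣A∣+ρX : ρ (A ∪ X) ≡ ∣ A ∣ + ρ X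
    ρ[A∪X]≡∣A∣+ρX = begin
      ρ (A ∪ X)     ≡⟨ A∪X-indep ⟩
      ∣ A ∪ X ∣     ≡⟨ ∣p∪q∣≡∣p∣+∣q∣ A⊆∁X ⟩
      ∣ A ∣ + ∣ X ∣ ≡⟨ cong (∣ A ∣ +_) X-indep ⟨
      ∣ A ∣ + ρ X   ∎
    ∣A∣≤k : ∣ A ∣ ≤ ρ ⊤ ∸ ρ X
    ∣A∣≤k = m+n≤o⇒m≤o∸n ∣ A ∣ (subst (_≤ ρ ⊤) ρ[A∪X]≡∣A∣+ρX (ρ≤ρ⊤ M (A ∪ X)))
  ... | no  A∪X-dep = trans (cong (_∸ ρ X) A∪X-spanning) (sym (m≥n⇒m⊓n≡n k≤∣A∣))
    where
    A∪X-spanning : ρ (A ∪ X) ≡ ρ ⊤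
    A∪X-spanning = dependent-⊇⇒spanning (q⊆p∪q A X) A∪X-dep
    k≤∣A∣ : ρ ⊤ ∸ ρ X ≤ ∣ A ∣
    k≤∣A∣ = m≤n+o⇒m∸n≤o (ρ ⊤) (ρ X) (begin
      ρ ⊤           ≡⟨ A∪X-spanning ⟨
      ρ (A ∪ X)     ≤⟨ ρ-bounded (A ∪ X) ⟩
      ∣ A ∪ X ∣     ≡⟨ ∣p∪q∣≡∣p∣+∣q∣ A⊆∁X ⟩
      ∣ A ∣ + ∣ X ∣ ≡⟨ +-comm ∣ A ∣ ∣ X ∣ ⟩
      ∣ X ∣ + ∣ A ∣ ≡⟨ cong (_+ ∣ A ∣) X-indep ⟨
      ρ X + ∣ A ∣   ∎)
      where open ≤-Reasoning

theorem4p5 : {m : ℕ} (M : Matroid m) (X : Subset m) → Independent M X →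
    ContractionIsoUniform M X ∣ ∁ X ∣ (Matroid.ρ M ⊤ ∸ Matroid.ρ M X)
      ⇔ (IsBasis M X
          ⊎ (IsFlat M X
             × (∀ Z → IsCyclicFlat M Z → Z ≢ 0𝒵 M → cl M (X ∪ Z) ≡ ⊤)))
theorem4p5 M X X-indep = mk⇔
  (λ iso → UniformContraction⇒IsBasis⊎IsFlat×Spans M
             (ContractionIsoUniform⇒UniformContraction M iso) X-indep)
  (UniformContraction⇒ContractionIsoUniform M ∘
    [ spanning⇒UniformContraction M ∘ IsBasis⇒spanning M
    , uncurry (IsFlat∧SpansWithCyclicFlats⇒UniformContraction M X-indep) ]′)
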